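{- If $G$ is a connected, well-dominated graph of order at least $3$ and $G \,\square\, H$ is well-dominated for some connected graph $H$ of order at least $2$, then $\delta(G) \ge 2$.
   Context: All graphs are finite, simple and undirected; $\delta(G)$ is the minimum degree. $\gamma(X)$ is the minimum size of a dominating set (a set $D$ with every vertex in $D$ or adjacent to a vertex of $D$), $\Gamma(X)$ the maximum size of an inclusion-minimal dominating set; $X$ is well-dominated if $\gamma(X)=\Gamma(X)$. The Cartesian product $G\,\square\, H$ has vertex set $V(G)\times V(H)$, with $(g_1,h_1)\sim(g_2,h_2)$ iff either $g_1=g_2$ and $h_1h_2\in E(H)$, or $h_1=h_2$ and $g_1g_2\in E(G)$. -}

module Defs where

open import Data.Nat using (ℕ; _≤_; _≥_; _*_)
open import Data.Bool using (Bool; true; false; T; _∧_; _∨_)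
open import Data.Fin using (Fin; remQuot)
open import Data.Fin.Properties using (_≟_)
open import Data.Fin.Subset using (Subset; _∈_; _⊆_; ∣_∣)
open import Data.Vec using (tabulate)
open import Data.Product using (Σ; _×_; _,_; ∃; proj₁; proj₂)
open import Data.Sum using (_⊎_)
open import Relation.Nullary.Decidable using (⌊_⌋)
open import Relation.Binary.PropositionalEquality using (_≡_; refl) renaming (sym to ≡-sym)
open import Relation.Nullary using (yes; no)
open import Data.Empty using (⊥-elim)

record Graph : Set where
  field
    order : ℕ
    adj   : Fin order → Fin order → Bool
    sym   : ∀ u v → adj u v ≡ adj v u
    irrefl : ∀ v → adj v v ≡ false

open Graph public

Adj : (G : Graph) → Fin (order G) → Fin (order G) → Set
Adj G u v = T (adj G u v)

data Reach (G : Graph) : Fin (order G) → Fin (order G) → Set where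
  here : ∀ {v} → Reach G v v
  step : ∀ {u v w} → Adj G u v → Reach G v w → Reach G u w

Connected : Graph → Set
Connected G = ∀ u v → Reach G u v

nbhd : (G : Graph) → Fin (order G) → Subset (order G)
nbhd G v = tabulate (λ u → adj G v u)

degree : (G : Graph) → Fin (order G) → ℕ
degree G v = ∣ nbhd G v ∣

MinDegreeAtLeast : Graph → ℕ → Set
MinDegreeAtLeast G k = ∀ v → k ≤ degree G v

Dominating : (G : Graph) → Subset (order G) → Set
Dominating G D = ∀ v → v ∈ D ⊎ Σ (Fin (order G)) (λ u → u ∈ D × Adj G u v)

MinimalDominating : (G : Graph) → Subset (order G) → Set
MinimalDominating G D =
  Dominating G D × (∀ D' → D' ⊆ D → Dominating G D' → D ⊆ D')

IsGamma : Graph → ℕ → Set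
IsGamma G k = Σ (Subset (order G)) (λ D → Dominating G D × ∣ D ∣ ≡ k)
            × (∀ D → Dominating G D → k ≤ ∣ D ∣)

IsUpperGamma : Graph → ℕ → Set
IsUpperGamma G k = Σ (Subset (order G)) (λ D → MinimalDominating G D × ∣ D ∣ ≡ k)
                 × (∀ D → MinimalDominating G D → ∣ D ∣ ≤ k)

WellDominated : Graph → Set
WellDominated G = ∃ λ k → IsGamma G k × IsUpperGamma G k

□-adj' : (G H : Graph) → Fin (order G) × Fin (order H) → Fin (order G) × Fin (order H) → Bool
□-adj' G H (g₁ , h₁) (g₂ , h₂) =
  (⌊ g₁ ≟ g₂ ⌋ ∧ adj H h₁ h₂) ∨ (⌊ h₁ ≟ h₂ ⌋ ∧ adj G g₁ g₂)

□-adj : (G H : Graph) → Fin (order G * order H) → Fin (order G * order H) → Bool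
□-adj G H x y = □-adj' G H (remQuot (order H) x) (remQuot (order H) y)

private
  ≟-sym : ∀ {n} (a b : Fin n) → ⌊ a ≟ b ⌋ ≡ ⌊ b ≟ a ⌋
  ≟-sym a b with a ≟ b | b ≟ a
  ... | yes _ | yes _ = refl
  ... | no _  | no _  = refl
  ... | yes p | no q  = ⊥-elim (q (≡-sym p))
  ... | no p  | yes q = ⊥-elim (p (≡-sym q))

  ≟-refl : ∀ {n} (a : Fin n) → ⌊ a ≟ a ⌋ ≡ true
  ≟-refl a with a ≟ a
  ... | yes _ = refl
  ... | no p  = ⊥-elim (p refl)

□-sym : (G H : Graph) → ∀ x y → □-adj G H x y ≡ □-adj G H y x
□-sym G H x y = go (remQuot (order H) x) (remQuot (order H) y)
  where
  go : ∀ p q → □-adj' G H p q ≡ □-adj' G H q p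
  go (g₁ , h₁) (g₂ , h₂) rewrite ≟-sym g₁ g₂ | sym H h₁ h₂ | ≟-sym h₁ h₂ | sym G g₁ g₂ = refl

□-irrefl : (G H : Graph) → ∀ x → □-adj G H x x ≡ false
□-irrefl G H x = go (remQuot (order H) x)
  where
  go : ∀ p → □-adj' G H p p ≡ false
  go (g , h) rewrite ≟-refl g | ≟-refl h | irrefl H h | irrefl G g = refl

_□_ : Graph → Graph → Graph
G □ H = record
  { order = order G * order H
  ; adj = □-adj G H
  ; sym = □-sym G H
  ; irrefl = □-irrefl G H
  }

-- Suppose some vertex v of G has degree at most 1. As G is connected with at least three
-- vertices, v is a leaf whose neighbour u has a further neighbour w. Extend {v, w} to a
-- maximal independent set C; it is a minimal dominating set, so |C| ≤ Γ(G) = γ(G). Removing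
-- the single vertex (v, h₀) from C × V(H) still leaves a dominating set of G □ H: (v, h₀) is
-- dominated inside its H-fibre, and (u, h₀) by (w, h₀). Hence γ(G □ H) < γ(G)·|H|. On the
-- other hand, by Bollobás and Cockayne G has a minimum dominating set B each of whose
-- vertices has an external private neighbour, and then B × V(H) is a minimal dominating set
-- of G □ H, so Γ(G □ H) ≥ γ(G)·|H|. Thus G □ H is not well-dominated.
module Submission where

open import Defs

open import Data.Bool using (T; _∧_)
open import Data.Bool.Properties using (T?; T-≡; T-∧; T-∨)
open import Data.Empty using (⊥-elim)
open import Data.Fin using (Fin; zero; suc; combine; remQuot; fromℕ<)
open import Data.Fin.Properties
  using (_≟_; any?; all?; ¬∀⟶∃¬; remQuot-combine; combine-remQuot; combine-injective)
open import Data.Fin.Subset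
  using (Subset; inside; outside; _∈_; _∉_; _⊆_; _⊂_; _⊃_; ∣_∣; ⁅_⁆; _∪_; _-_; ⊤)
open import Data.Fin.Subset.Properties
  using ( _∈?_; ∣⊤∣≡n; ∣⊥∣≡0; ∣⁅x⁆∣≡1; x∈⁅x⁆; x∈⁅y⁆⇒x≡y; p⊆p∪q; q⊆p∪q; x∈p∪q⁻
        ; p⊆q⇒∣p∣≤∣q∣; p─q⊆p; x∈p∧x≢y⇒x∈p-y; x∈p⇒∣p-x∣<∣p∣)
open import Data.Fin.Subset.Induction using (Acc; acc; ⊂-wellFounded; ⊃-wellFounded)
open import Data.Nat using (suc; _+_; _*_; _≤_; _<_; _≥_; z≤n; s≤s; _≤?_)
open import Data.Nat.Properties
  using (≤-trans; ≤-<-trans; <⇒≱; ≰⇒>; +-suc; +-comm; n≤1+n; +-monoʳ-≤; *-monoˡ-≤; module ≤-Reasoning)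
open import Data.Product using (∃; ∃₂; _×_; _,_; proj₁; proj₂)
import Data.Product as Product
open import Data.Sum using (_⊎_; inj₁; inj₂; [_,_])
import Data.Sum as Sum
open import Data.Vec using ([]; _∷_; there; _++_; concat; map; replicate; tabulate; lookup)
open import Data.Vec.Properties
  using (lookup-concat; lookup-map; lookup-replicate; lookup∘tabulate; []=⇒lookup; lookup⇒[]=)
open import Function using (_∘_)
open import Function.Bundles using (module Equivalence)
open import Relation.Nullary using (¬_; Dec; yes; no)
open import Relation.Nullary.Decidable
  using (⌊_⌋; toWitness; fromWitness; decidable-stable; _×-dec_; _⊎-dec_; _→-dec_; ¬?)
open import Relation.Unary using (Decidable)
open import Relation.Binary.PropositionalEquality
  using (_≡_; _≢_; refl; trans; cong; cong₂; subst; module ≡-Reasoning)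
  renaming (sym to ≡-sym)

open Equivalence using (to; from)

∣p∪q∣≤∣p∣+∣q∣ : ∀ {n} (p q : Subset n) → ∣ p ∪ q ∣ ≤ ∣ p ∣ + ∣ q ∣
∣p∪q∣≤∣p∣+∣q∣ []            []            = z≤n
∣p∪q∣≤∣p∣+∣q∣ (inside  ∷ p) (inside  ∷ q) =
  s≤s (≤-trans (∣p∪q∣≤∣p∣+∣q∣ p q) (+-monoʳ-≤ ∣ p ∣ (n≤1+n ∣ q ∣)))
∣p∪q∣≤∣p∣+∣q∣ (inside  ∷ p) (outside ∷ q) = s≤s (∣p∪q∣≤∣p∣+∣q∣ p q)
∣p∪q∣≤∣p∣+∣q∣ (outside ∷ p) (inside  ∷ q) =
  subst (suc ∣ p ∪ q ∣ ≤_) (≡-sym (+-suc ∣ p ∣ ∣ q ∣)) (s≤s (∣p∪q∣≤∣p∣+∣q∣ p q))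
∣p∪q∣≤∣p∣+∣q∣ (outside ∷ p) (outside ∷ q) = ∣p∪q∣≤∣p∣+∣q∣ p q

∣p++q∣≡∣p∣+∣q∣ : ∀ {m n} (p : Subset m) (q : Subset n) → ∣ p ++ q ∣ ≡ ∣ p ∣ + ∣ q ∣
∣p++q∣≡∣p∣+∣q∣ []            q = refl
∣p++q∣≡∣p∣+∣q∣ (inside  ∷ p) q = cong suc (∣p++q∣≡∣p∣+∣q∣ p q)
∣p++q∣≡∣p∣+∣q∣ (outside ∷ p) q = ∣p++q∣≡∣p∣+∣q∣ p q

∣concat-map-replicate∣ : ∀ {m} n (p : Subset m) → ∣ concat (map (replicate n) p) ∣ ≡ ∣ p ∣ * n
∣concat-map-replicate∣ n []            = refl
∣concat-map-replicate∣ n (inside  ∷ p) =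
  trans (∣p++q∣≡∣p∣+∣q∣ (replicate n inside) _) (cong₂ _+_ (∣⊤∣≡n n) (∣concat-map-replicate∣ n p))
∣concat-map-replicate∣ n (outside ∷ p) =
  trans (∣p++q∣≡∣p∣+∣q∣ (replicate n outside) _) (cong₂ _+_ (∣⊥∣≡0 n) (∣concat-map-replicate∣ n p))

x∉p-x : ∀ {n} (p : Subset n) x → x ∉ p - x
x∉p-x (s ∷ p) zero    ()
x∉p-x (s ∷ p) (suc x) (there x∈p-x) = x∉p-x p x x∈p-x

x∉p⇒p⊂p∪⁅x⁆ : ∀ {n} {p : Subset n} {x} → x ∉ p → p ⊂ p ∪ ⁅ x ⁆
x∉p⇒p⊂p∪⁅x⁆ {p = p} {x} x∉p = p⊆p∪q ⁅ x ⁆ , x , q⊆p∪q p ⁅ x ⁆ (x∈⁅x⁆ x) , x∉p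

two-elements⇒2≤∣p∣ : ∀ {n} {p : Subset n} {x y} → x ∈ p → y ∈ p → x ≢ y → 2 ≤ ∣ p ∣
two-elements⇒2≤∣p∣ x∈p y∈p x≢y =
  ≤-trans (s≤s (≤-trans (s≤s z≤n) (x∈p⇒∣p-x∣<∣p∣ (x∈p∧x≢y⇒x∈p-y y∈p (x≢y ∘ ≡-sym)))))
          (x∈p⇒∣p-x∣<∣p∣ x∈p)

∣p∣<n⇒∃∉p : ∀ {n} (p : Subset n) → ∣ p ∣ < n → ∃ (_∉ p)
∣p∣<n⇒∃∉p {n} p ∣p∣<n = ¬∀⟶∃¬ n (_∈ p) (_∈? p) λ all∈p →
  <⇒≱ ∣p∣<n (subst (_≤ ∣ p ∣) (∣⊤∣≡n n) (p⊆q⇒∣p∣≤∣q∣ {p = ⊤} (λ {x} _ → all∈p x)))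

module _ {n} {P : Fin n → Set} (P? : Decidable P) where

  satisfying : Subset n
  satisfying = tabulate (λ x → ⌊ P? x ⌋)

  ∈-satisfying⁺ : ∀ {x} → P x → x ∈ satisfying
  ∈-satisfying⁺ {x} px =
    lookup⇒[]= x _ (trans (lookup∘tabulate _ x) (to T-≡ (fromWitness px)))

  ∈-satisfying⁻ : ∀ {x} → x ∈ satisfying → P x
  ∈-satisfying⁻ {x} x∈ =
    toWitness (from T-≡ (trans (≡-sym (lookup∘tabulate _ x)) ([]=⇒lookup x∈)))

module _ (G : Graph) where

  Vertex : Set
  Vertex = Fin (order G)

  Adj-sym : ∀ {a b} → Adj G a b → Adj G b a
  Adj-sym {a} {b} = subst T (sym G a b)

  Adj-irrefl : ∀ {a b} → Adj G a b → a ≢ b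
  Adj-irrefl {a} a~a refl = subst T (irrefl G a) a~a

  Adj? : ∀ a b → Dec (Adj G a b)
  Adj? a b = T? (adj G a b)

  Adj⇒∈nbhd : ∀ {v a} → Adj G v a → a ∈ nbhd G v
  Adj⇒∈nbhd {v} {a} v~a = lookup⇒[]= a _ (trans (lookup∘tabulate (adj G v) a) (to T-≡ v~a))

  Dominates : Subset (order G) → Vertex → Set
  Dominates D v = v ∈ D ⊎ ∃ λ u → u ∈ D × Adj G u v

  Dominates? : ∀ D v → Dec (Dominates D v)
  Dominates? D v = (v ∈? D) ⊎-dec any? (λ u → (u ∈? D) ×-dec Adj? u v)

  Dominates-mono : ∀ {D D′ v} → D ⊆ D′ → Dominates D v → Dominates D′ v
  Dominates-mono D⊆D′ (inj₁ v∈D)               = inj₁ (D⊆D′ v∈D)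
  Dominates-mono D⊆D′ (inj₂ (u , u∈D , u~v)) = inj₂ (u , D⊆D′ u∈D , u~v)

  Independent : Subset (order G) → Set
  Independent S = ∀ {a b} → a ∈ S → b ∈ S → ¬ Adj G a b

  independent-⁅⁆ : ∀ v → Independent ⁅ v ⁆
  independent-⁅⁆ v a∈ b∈ a~b = Adj-irrefl a~b (trans (x∈⁅y⁆⇒x≡y v a∈) (≡-sym (x∈⁅y⁆⇒x≡y v b∈)))

  independent-∪-undominated : ∀ {S x} → Independent S → ¬ Dominates S x → Independent (S ∪ ⁅ x ⁆)
  independent-∪-undominated {S} {x} ind ¬dom {a} {b} a∈ b∈ a~b
    with x∈p∪q⁻ S ⁅ x ⁆ a∈ | x∈p∪q⁻ S ⁅ x ⁆ b∈
  ... | inj₁ a∈S | inj₁ b∈S = ind a∈S b∈S a~b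
  ... | inj₁ a∈S | inj₂ b∈x = ¬dom (inj₂ (a , a∈S , subst (Adj G a) (x∈⁅y⁆⇒x≡y x b∈x) a~b))
  ... | inj₂ a∈x | inj₁ b∈S = ¬dom (inj₂ (b , b∈S , subst (Adj G b) (x∈⁅y⁆⇒x≡y x a∈x) (Adj-sym a~b)))
  ... | inj₂ a∈x | inj₂ b∈x = independent-⁅⁆ x a∈x b∈x a~b

  independent-dominating⇒minimal : ∀ {C} → Independent C → Dominating G C → MinimalDominating G C
  independent-dominating⇒minimal {C} ind dom = dom , minimal
    where
    minimal : ∀ D′ → D′ ⊆ C → Dominating G D′ → C ⊆ D′
    minimal D′ D′⊆C dom′ {c} c∈C with dom′ c
    ... | inj₁ c∈D′             = c∈D′
    ... | inj₂ (u , u∈D′ , u~c) = ⊥-elim (ind (D′⊆C u∈D′) c∈C u~c)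

  extend-to-independent-dominating : ∀ {S} → Independent S → ∃ λ C → S ⊆ C × Independent C × Dominating G C
  extend-to-independent-dominating ind = go ind (⊃-wellFounded _)
    where
    go : ∀ {S} → Independent S → Acc _⊃_ S → ∃ λ C → S ⊆ C × Independent C × Dominating G C
    go {S} ind (acc larger) with any? (λ x → ¬? (Dominates? S x))
    ... | no none-undominated =
      S , (λ x∈S → x∈S) , ind ,
      λ x → decidable-stable (Dominates? S x) (λ ¬dom → none-undominated (x , ¬dom))
    ... | yes (x , ¬dom) with go (independent-∪-undominated ind ¬dom) (larger (x∉p⇒p⊂p∪⁅x⁆ (¬dom ∘ inj₁)))
    ... | C , S∪x⊆C , indC , domC = C , S∪x⊆C ∘ p⊆p∪q ⁅ x ⁆ , indC , domC

  walk-enters : ∀ {S x y} → Reach G x y → x ∉ S → y ∈ S → ∃₂ λ a b → a ∉ S × b ∈ S × Adj G a b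
  walk-enters here                  x∉S x∈S = ⊥-elim (x∉S x∈S)
  walk-enters {S} (step {u} {v} u~v walk) u∉S y∈S with v ∈? S
  ... | yes v∈S = u , v , u∉S , v∈S , u~v
  ... | no  v∉S = walk-enters walk v∉S y∈S

  connected⇒neighbour : Connected G → 2 ≤ order G → ∀ v → ∃ (Adj G v)
  connected⇒neighbour conn 2≤n v
    with ∣p∣<n⇒∃∉p ⁅ v ⁆ (subst (_< order G) (≡-sym (∣⁅x⁆∣≡1 v)) 2≤n)
  ... | z , z∉v with walk-enters (conn z v) z∉v (x∈⁅x⁆ v)
  ... | a , b , _ , b∈v , a~b = a , Adj-sym (subst (Adj G a) (x∈⁅y⁆⇒x≡y v b∈v) a~b)

  record Pendant (v : Vertex) : Set where
    field
      support        : Vertex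
      only-neighbour : ∀ {a} → Adj G v a → a ≡ support
      second         : Vertex
      support~second : Adj G support second
      second≢v       : second ≢ v

  degree<2⇒unique-neighbour : ∀ {v a b} → degree G v < 2 → Adj G v a → Adj G v b → a ≡ b
  degree<2⇒unique-neighbour {a = a} {b} deg<2 v~a v~b with a ≟ b
  ... | yes a≡b = a≡b
  ... | no  a≢b = ⊥-elim (<⇒≱ deg<2 (two-elements⇒2≤∣p∣ (Adj⇒∈nbhd v~a) (Adj⇒∈nbhd v~b) a≢b))

  degree<2⇒pendant : Connected G → 3 ≤ order G → ∀ v → degree G v < 2 → Pendant v
  degree<2⇒pendant conn 3≤n v deg<2 with connected⇒neighbour conn (≤-trans (s≤s (s≤s z≤n)) 3≤n) v
  ... | u , v~u with ∣p∣<n⇒∃∉p (⁅ u ⁆ ∪ ⁅ v ⁆) ∣uv∣<n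
    where
    ∣uv∣<n : ∣ ⁅ u ⁆ ∪ ⁅ v ⁆ ∣ < order G
    ∣uv∣<n = ≤-<-trans (∣p∪q∣≤∣p∣+∣q∣ ⁅ u ⁆ ⁅ v ⁆)
               (subst (_< order G) (≡-sym (cong₂ _+_ (∣⁅x⁆∣≡1 u) (∣⁅x⁆∣≡1 v))) 3≤n)
  ... | z , z∉uv with walk-enters (conn z v) z∉uv (q⊆p∪q ⁅ u ⁆ ⁅ v ⁆ (x∈⁅x⁆ v))
  ... | w , b , w∉uv , b∈uv , w~b = record
    { support = u ; only-neighbour = only-u ; second = w ; support~second = u~w ; second≢v = w≢v }
    where
    only-u : ∀ {a} → Adj G v a → a ≡ u
    only-u v~a = degree<2⇒unique-neighbour deg<2 v~a v~u

    u~w : Adj G u w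
    u~w with x∈p∪q⁻ ⁅ u ⁆ ⁅ v ⁆ b∈uv
    ... | inj₁ b∈u = Adj-sym (subst (Adj G w) (x∈⁅y⁆⇒x≡y u b∈u) w~b)
    ... | inj₂ b∈v = ⊥-elim (w∉uv (p⊆p∪q ⁅ v ⁆ (subst (_∈ ⁅ u ⁆) (≡-sym (only-u v~w)) (x∈⁅x⁆ u))))
      where
      v~w : Adj G v w
      v~w = Adj-sym (subst (Adj G w) (x∈⁅y⁆⇒x≡y v b∈v) w~b)

    w≢v : w ≢ v
    w≢v refl = w∉uv (q⊆p∪q ⁅ u ⁆ ⁅ w ⁆ (x∈⁅x⁆ w))

  ExternalPrivate : Subset (order G) → Vertex → Vertex → Set
  ExternalPrivate D d p = p ∉ D × Adj G d p × (∀ b → b ∈ D → Adj G b p → b ≡ d)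

  HasExternalPrivate : Subset (order G) → Vertex → Set
  HasExternalPrivate D d = ∃ (ExternalPrivate D d)

  HasExternalPrivate? : ∀ D d → Dec (HasExternalPrivate D d)
  HasExternalPrivate? D d = any? λ p →
    ¬? (p ∈? D) ×-dec Adj? d p ×-dec all? (λ b → (b ∈? D) →-dec Adj? b p →-dec (b ≟ d))

  IsolatedIn : Subset (order G) → Vertex → Set
  IsolatedIn D d = d ∈ D × (∀ b → b ∈ D → ¬ Adj G b d)

  IsolatedIn? : ∀ D d → Dec (IsolatedIn D d)
  IsolatedIn? D d = (d ∈? D) ×-dec all? (λ b → (b ∈? D) →-dec ¬? (Adj? b d))

  MinimumDominating : Subset (order G) → Set
  MinimumDominating D = Dominating G D × (∀ D′ → Dominating G D′ → ∣ D ∣ ≤ ∣ D′ ∣)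

  dominates-after-removal : ∀ {D d y} → Dominating G D → y ≢ d →
                            Dominates (D - d) y ⊎ ExternalPrivate D d y
  dominates-after-removal {D} {d} {y} dom y≢d with Dominates? (D - d) y
  ... | yes dom′ = inj₁ dom′
  ... | no ¬dom′ = inj₂ (y∉D , d~y , only-d)
    where
    only-d : ∀ b → b ∈ D → Adj G b y → b ≡ d
    only-d b b∈D b~y with b ≟ d
    ... | yes b≡d = b≡d
    ... | no  b≢d = ⊥-elim (¬dom′ (inj₂ (b , x∈p∧x≢y⇒x∈p-y b∈D b≢d , b~y)))

    y∉D : y ∉ D
    y∉D y∈D = ¬dom′ (inj₁ (x∈p∧x≢y⇒x∈p-y y∈D y≢d))

    d~y : Adj G d y
    d~y with dom y
    ... | inj₁ y∈D             = ⊥-elim (y∉D y∈D)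
    ... | inj₂ (b , b∈D , b~y) = subst (λ c → Adj G c y) (only-d b b∈D b~y) b~y

  minimum-without-private⇒isolated : ∀ {D d} → MinimumDominating D → d ∈ D →
                                      ¬ HasExternalPrivate D d → IsolatedIn D d
  minimum-without-private⇒isolated {D} {d} (dom , minimum) d∈D no-private =
    d∈D , λ b b∈D b~d → d-undominated (inj₂ (b , x∈p∧x≢y⇒x∈p-y b∈D (Adj-irrefl b~d) , b~d))
    where
    d-undominated : ¬ Dominates (D - d) d
    d-undominated with ¬∀⟶∃¬ _ _ (Dominates? (D - d))
                         (λ dom′ → <⇒≱ (x∈p⇒∣p-x∣<∣p∣ d∈D) (minimum (D - d) dom′))
    ... | y , ¬dom-y with y ≟ d
    ...   | yes refl = ¬dom-y
    ...   | no  y≢d  = ⊥-elim ([ ¬dom-y , (λ priv → no-private (y , priv)) ]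
                                 (dominates-after-removal dom y≢d))

  isolated : Subset (order G) → Subset (order G)
  isolated D = satisfying (IsolatedIn? D)

  module Exchange {D d x} (no-private : ¬ HasExternalPrivate D d) (d~x : Adj G d x) where

    D′ : Subset (order G)
    D′ = (D - d) ∪ ⁅ x ⁆

    D-d⊆D′ : D - d ⊆ D′
    D-d⊆D′ = p⊆p∪q ⁅ x ⁆

    exchange-dominating : Dominating G D → Dominating G D′
    exchange-dominating dom y with y ≟ d
    ... | yes refl = inj₂ (x , q⊆p∪q (D - d) ⁅ x ⁆ (x∈⁅x⁆ x) , Adj-sym d~x)
    ... | no  y≢d with dominates-after-removal dom y≢d
    ...   | inj₁ dom′ = Dominates-mono D-d⊆D′ dom′
    ...   | inj₂ priv = ⊥-elim (no-private (y , priv))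

    ∣D′∣≤∣D∣ : d ∈ D → ∣ D′ ∣ ≤ ∣ D ∣
    ∣D′∣≤∣D∣ d∈D = begin
      ∣ D′ ∣                 ≤⟨ ∣p∪q∣≤∣p∣+∣q∣ (D - d) ⁅ x ⁆ ⟩
      ∣ D - d ∣ + ∣ ⁅ x ⁆ ∣ ≡⟨ cong (∣ D - d ∣ +_) (∣⁅x⁆∣≡1 x) ⟩
      ∣ D - d ∣ + 1         ≡⟨ +-comm ∣ D - d ∣ 1 ⟩
      suc ∣ D - d ∣         ≤⟨ x∈p⇒∣p-x∣<∣p∣ d∈D ⟩
      ∣ D ∣                 ∎
      where open ≤-Reasoning

    exchange-minimum : d ∈ D → MinimumDominating D → MinimumDominating D′
    exchange-minimum d∈D (dom , minimum) =
      exchange-dominating dom , λ E domE → ≤-trans (∣D′∣≤∣D∣ d∈D) (minimum E domE)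

    module _ (d-isolated : IsolatedIn D d) where

      x-not-isolated : ¬ IsolatedIn D′ x
      x-not-isolated (_ , no-neighbour) = no-private (x , x∉D , d~x , only-d)
        where
        x∉D : x ∉ D
        x∉D x∈D = proj₂ d-isolated x x∈D (Adj-sym d~x)

        only-d : ∀ b → b ∈ D → Adj G b x → b ≡ d
        only-d b b∈D b~x with b ≟ d
        ... | yes b≡d = b≡d
        ... | no  b≢d = ⊥-elim (no-neighbour b (D-d⊆D′ (x∈p∧x≢y⇒x∈p-y b∈D b≢d)) b~x)

      still-isolated : ∀ {y} → IsolatedIn D′ y → IsolatedIn D y
      still-isolated {y} y-isolated@(y∈D′ , no-neighbour) with x∈p∪q⁻ (D - d) ⁅ x ⁆ y∈D′
      ... | inj₂ y∈x  = ⊥-elim (x-not-isolated (subst (IsolatedIn D′) (x∈⁅y⁆⇒x≡y x y∈x) y-isolated))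
      ... | inj₁ y∈D-d = y∈D , no-D-neighbour
        where
        y∈D : y ∈ D
        y∈D = p─q⊆p D ⁅ d ⁆ y∈D-d

        no-D-neighbour : ∀ b → b ∈ D → ¬ Adj G b y
        no-D-neighbour b b∈D b~y with b ≟ d
        ... | yes refl = proj₂ d-isolated y y∈D (Adj-sym b~y)
        ... | no  b≢d  = no-neighbour b (D-d⊆D′ (x∈p∧x≢y⇒x∈p-y b∈D b≢d)) b~y

      d∉D′ : d ∉ D′
      d∉D′ d∈D′ with x∈p∪q⁻ (D - d) ⁅ x ⁆ d∈D′
      ... | inj₁ d∈D-d = x∉p-x D d d∈D-d
      ... | inj₂ d∈x   = Adj-irrefl d~x (x∈⁅y⁆⇒x≡y x d∈x)

      exchange-isolated : isolated D′ ⊂ isolated D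
      exchange-isolated =
        (λ y∈ → ∈-satisfying⁺ _ (still-isolated (∈-satisfying⁻ _ y∈))) ,
        d , ∈-satisfying⁺ _ d-isolated , (λ d∈ → d∉D′ (proj₁ (∈-satisfying⁻ _ d∈)))

  -- Bollobás–Cockayne: a vertex of D without an external private neighbour is isolated in D, and
  -- exchanging it for one of its neighbours keeps D minimum while shrinking its isolated vertices.
  minimum-dominating-with-private-neighbours :
    (∀ v → ∃ (Adj G v)) → ∀ {D} → MinimumDominating D →
    ∃ λ B → MinimumDominating B × (∀ {b} → b ∈ B → HasExternalPrivate B b)
  minimum-dominating-with-private-neighbours neighbour minD = go minD (⊂-wellFounded _)
    where
    go : ∀ {D} → MinimumDominating D → Acc _⊂_ (isolated D) →
         ∃ λ B → MinimumDominating B × (∀ {b} → b ∈ B → HasExternalPrivate B b)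
    go {D} minD (acc smaller) with any? (λ d → (d ∈? D) ×-dec ¬? (HasExternalPrivate? D d))
    ... | no none = D , minD , λ {d} d∈D →
      decidable-stable (HasExternalPrivate? D d) (λ no-private → none (d , d∈D , no-private))
    ... | yes (d , d∈D , no-private) =
      go (exchange-minimum d∈D minD) (smaller (exchange-isolated d-isolated))
      where
      open Exchange no-private (proj₂ (neighbour d))
      d-isolated : IsolatedIn D d
      d-isolated = minimum-without-private⇒isolated minD d∈D no-private

module _ (G H : Graph) where

  data PairView : Vertex (G □ H) → Set where
    ⟨_,_⟩ : (g : Vertex G) (h : Vertex H) → PairView (combine g h)

  pairView : ∀ x → PairView x
  pairView x = subst PairView (combine-remQuot {order G} (order H) x)
    ⟨ proj₁ (remQuot {order G} (order H) x) , proj₂ (remQuot {order G} (order H) x) ⟩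

  adj-□-combine : ∀ g h g′ h′ → adj (G □ H) (combine g h) (combine g′ h′)
                ≡ □-adj' G H (g , h) (g′ , h′)
  adj-□-combine g h g′ h′ = cong₂ (□-adj' G H) (remQuot-combine g h) (remQuot-combine g′ h′)

  □-Adjᴴ : ∀ g {h h′} → Adj H h h′ → Adj (G □ H) (combine g h) (combine g h′)
  □-Adjᴴ g {h} {h′} h~h′ = subst T (≡-sym (adj-□-combine g h g h′))
    (from (T-∨ {⌊ g ≟ g ⌋ ∧ adj H h h′}) (inj₁ (from T-∧ (fromWitness {a? = g ≟ g} refl , h~h′))))

  □-Adjᴳ : ∀ {g g′} h → Adj G g g′ → Adj (G □ H) (combine g h) (combine g′ h)
  □-Adjᴳ {g} {g′} h g~g′ = subst T (≡-sym (adj-□-combine g h g′ h))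
    (from (T-∨ {⌊ g ≟ g′ ⌋ ∧ adj H h h}) (inj₂ (from T-∧ (fromWitness {a? = h ≟ h} refl , g~g′))))

  □-Adj⁻ : ∀ {g h g′ h′} → Adj (G □ H) (combine g h) (combine g′ h′) →
           (g ≡ g′ × Adj H h h′) ⊎ (h ≡ h′ × Adj G g g′)
  □-Adj⁻ {g} {h} {g′} {h′} a =
    Sum.map (Product.map₁ (toWitness {a? = g ≟ g′}) ∘ to T-∧)
            (Product.map₁ (toWitness {a? = h ≟ h′}) ∘ to T-∧)
            (to (T-∨ {⌊ g ≟ g′ ⌋ ∧ adj H h h′}) (subst T (adj-□-combine g h g′ h′) a))

  dominating-□ : ∀ {D} → (∀ g h → Dominates (G □ H) D (combine g h)) → Dominating (G □ H) D
  dominating-□ dom x with pairView x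
  ... | ⟨ g , h ⟩ = dom g h

  -- B × V(H): the pair (g , h) is encoded as combine g h, the (g · |H| + h)-th vertex.
  fibres : Subset (order G) → Subset (order (G □ H))
  fibres B = concat (map (replicate (order H)) B)

  ∣fibres∣ : ∀ B → ∣ fibres B ∣ ≡ ∣ B ∣ * order H
  ∣fibres∣ = ∣concat-map-replicate∣ (order H)

  lookup-fibres : ∀ B g h → lookup (fibres B) (combine g h) ≡ lookup B g
  lookup-fibres B g h = begin
    lookup (fibres B) (combine g h)                   ≡⟨ lookup-concat (map (replicate _) B) g h ⟩
    lookup (lookup (map (replicate _) B) g) h         ≡⟨ cong (λ r → lookup r h) (lookup-map g _ B) ⟩
    lookup (replicate _ (lookup B g)) h               ≡⟨ lookup-replicate h _ ⟩
    lookup B g                                        ∎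
    where open ≡-Reasoning

  combine∈fibres⁺ : ∀ {B g} h → g ∈ B → combine g h ∈ fibres B
  combine∈fibres⁺ {B} {g} h g∈B = lookup⇒[]= _ _ (trans (lookup-fibres B g h) ([]=⇒lookup g∈B))

  combine∈fibres⁻ : ∀ {B g h} → combine g h ∈ fibres B → g ∈ B
  combine∈fibres⁻ {B} {g} {h} gh∈ = lookup⇒[]= g B (trans (≡-sym (lookup-fibres B g h)) ([]=⇒lookup gh∈))

  fibres-dominating : ∀ {B} → Dominating G B → Dominating (G □ H) (fibres B)
  fibres-dominating {B} domB = dominating-□ λ g h → lift g h (domB g)
    where
    lift : ∀ g h → Dominates G B g → Dominates (G □ H) (fibres B) (combine g h)
    lift g h (inj₁ g∈B)             = inj₁ (combine∈fibres⁺ h g∈B)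
    lift g h (inj₂ (b , b∈B , b~g)) = inj₂ (combine b h , combine∈fibres⁺ h b∈B , □-Adjᴳ h b~g)

  -- The private neighbour p of b forces every fibre vertex (b , h): only (b , h) can dominate (p , h).
  fibres-minimal : ∀ {B} → Dominating G B → (∀ {b} → b ∈ B → HasExternalPrivate G B b) →
                   MinimalDominating (G □ H) (fibres B)
  fibres-minimal {B} domB private-neighbour = fibres-dominating domB , minimal
    where
    kept : ∀ D′ → D′ ⊆ fibres B → Dominating (G □ H) D′ → ∀ {b} h → b ∈ B → combine b h ∈ D′
    kept D′ D′⊆ dom′ h b∈B with private-neighbour b∈B
    ... | p , p∉B , _ , only-b with dom′ (combine p h)
    ...   | inj₁ ph∈D′ = ⊥-elim (p∉B (combine∈fibres⁻ (D′⊆ ph∈D′)))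
    ...   | inj₂ (z , z∈D′ , z~ph) with pairView z
    ...     | ⟨ g , h′ ⟩ with □-Adj⁻ z~ph
    ...       | inj₁ (refl , _) = ⊥-elim (p∉B (combine∈fibres⁻ (D′⊆ z∈D′)))
    ...       | inj₂ (refl , g~p) with only-b g (combine∈fibres⁻ (D′⊆ z∈D′)) g~p
    ...         | refl = z∈D′

    minimal : ∀ D′ → D′ ⊆ fibres B → Dominating (G □ H) D′ → fibres B ⊆ D′
    minimal D′ D′⊆ dom′ {x} x∈ with pairView x
    ... | ⟨ b , h ⟩ = kept D′ D′⊆ dom′ h (combine∈fibres⁻ x∈)

  fibres-minus-dominating : ∀ {C v h₀ h₁} → Dominating G C → (pendant : Pendant G v) →
                            v ∈ C → Pendant.second pendant ∈ C → Adj H h₀ h₁ →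
                            Dominating (G □ H) (fibres C - combine v h₀)
  fibres-minus-dominating {C} {v} {h₀} {h₁} domC pendant v∈C w∈C h₀~h₁ = dominating-□ at
    where
    open Pendant pendant renaming (second to w)

    S : Subset (order (G □ H))
    S = fibres C - combine v h₀

    ∈S : ∀ {g h} → g ∈ C → ¬ (g ≡ v × h ≡ h₀) → combine g h ∈ S
    ∈S {g} {h} g∈C ≢vh₀ = x∈p∧x≢y⇒x∈p-y (combine∈fibres⁺ h g∈C) (≢vh₀ ∘ combine-injective g h v h₀)

    off-corner : ∀ g h → ¬ (g ≡ v × h ≡ h₀) → Dominates G C g → Dominates (G □ H) S (combine g h)
    off-corner g h ≢vh₀ (inj₁ g∈C) = inj₁ (∈S g∈C ≢vh₀)
    off-corner g h ≢vh₀ (inj₂ (c , c∈C , c~g)) with (c ≟ v) ×-dec (h ≟ h₀)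
    ... | no  ≢ch₀        = inj₂ (combine c h , ∈S c∈C ≢ch₀ , □-Adjᴳ h c~g)
    ... | yes (refl , refl) = inj₂ (combine w h₀ , ∈S w∈C (second≢v ∘ proj₁) , □-Adjᴳ h₀ w~g)
      where
      w~g : Adj G w g
      w~g = subst (Adj G w) (≡-sym (only-neighbour c~g)) (Adj-sym G support~second)

    at : ∀ g h → Dominates (G □ H) S (combine g h)
    at g h with (g ≟ v) ×-dec (h ≟ h₀)
    ... | yes (refl , refl) =
      inj₂ (combine v h₁ , ∈S v∈C (Adj-irrefl H h₀~h₁ ∘ ≡-sym ∘ proj₂) , □-Adjᴴ v (Adj-sym H h₀~h₁))
    ... | no ≢vh₀ = off-corner g h ≢vh₀ (domC g)

Γ-□-lower-bound : ∀ G H {k K} → (∀ v → ∃ (Adj G v)) → IsGamma G k → IsUpperGamma (G □ H) K →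
                  k * order H ≤ K
Γ-□-lower-bound G H {k} {K} neighbour ((D , domD , ∣D∣≡k) , γ-least) (_ , Γ-greatest) =
  bound (minimum-dominating-with-private-neighbours G neighbour minD)
  where
  minD : MinimumDominating G D
  minD = domD , λ D′ domD′ → subst (_≤ ∣ D′ ∣) (≡-sym ∣D∣≡k) (γ-least D′ domD′)

  bound : (∃ λ B → MinimumDominating G B × (∀ {b} → b ∈ B → HasExternalPrivate G B b)) →
          k * order H ≤ K
  bound (B , (domB , _) , private-neighbour) = begin
    k * order H      ≤⟨ *-monoˡ-≤ (order H) (γ-least B domB) ⟩
    ∣ B ∣ * order H  ≡⟨ ∣fibres∣ G H B ⟨
    ∣ fibres G H B ∣ ≤⟨ Γ-greatest _ (fibres-minimal G H domB private-neighbour) ⟩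
    K                ∎
    where open ≤-Reasoning

γ-□-upper-bound : ∀ G H {v k K} → Pendant G v → ∃₂ (Adj H) → IsUpperGamma G k → IsGamma (G □ H) K →
                  K < k * order H
γ-□-upper-bound G H {v} {k} {K} pendant (h₀ , h₁ , h₀~h₁) (_ , Γ-greatest) (_ , γ-least) =
  bound (extend-to-independent-dominating G (independent-∪-undominated G (independent-⁅⁆ G v) w-undominated))
  where
  open Pendant pendant renaming (second to w)

  w-undominated : ¬ Dominates G ⁅ v ⁆ w
  w-undominated (inj₁ w∈v)             = second≢v (x∈⁅y⁆⇒x≡y v w∈v)
  w-undominated (inj₂ (a , a∈v , a~w)) =
    Adj-irrefl G support~second (≡-sym (only-neighbour (subst (λ c → Adj G c w) (x∈⁅y⁆⇒x≡y v a∈v) a~w)))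

  bound : (∃ λ C → ⁅ v ⁆ ∪ ⁅ w ⁆ ⊆ C × Independent G C × Dominating G C) → K < k * order H
  bound (C , vw⊆C , indC , domC) = begin-strict
    K                              ≤⟨ γ-least _ (fibres-minus-dominating G H domC pendant v∈C w∈C h₀~h₁) ⟩
    ∣ fibres G H C - combine v h₀ ∣ <⟨ x∈p⇒∣p-x∣<∣p∣ (combine∈fibres⁺ G H h₀ v∈C) ⟩
    ∣ fibres G H C ∣               ≡⟨ ∣fibres∣ G H C ⟩
    ∣ C ∣ * order H                ≤⟨ *-monoˡ-≤ (order H) (Γ-greatest C C-minimal) ⟩
    k * order H                    ∎
    where
    open ≤-Reasoning
    v∈C : v ∈ C
    v∈C = vw⊆C (p⊆p∪q ⁅ w ⁆ (x∈⁅x⁆ v))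
    w∈C : w ∈ C
    w∈C = vw⊆C (q⊆p∪q ⁅ v ⁆ ⁅ w ⁆ (x∈⁅x⁆ w))
    C-minimal : MinimalDominating G C
    C-minimal = independent-dominating⇒minimal G indC domC

corollary4 : (G : Graph) → Connected G → WellDominated G → order G ≥ 3
    → (H : Graph) → Connected H → order H ≥ 2 → WellDominated (G □ H)
    → MinDegreeAtLeast G 2
corollary4 G conG (k , γG , ΓG) 3≤G H conH 2≤H (K , γX , ΓX) v with 2 ≤? degree G v
... | yes 2≤deg = 2≤deg
... | no  2≰deg = ⊥-elim (<⇒≱ upper lower)
  where
  lower : k * order H ≤ K
  lower = Γ-□-lower-bound G H (connected⇒neighbour G conG (≤-trans (s≤s (s≤s z≤n)) 3≤G)) γG ΓX

  H-edge : ∃₂ (Adj H)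
  H-edge = let h₀ = fromℕ< (≤-trans (s≤s z≤n) 2≤H) in h₀ , connected⇒neighbour H conH 2≤H h₀

  upper : K < k * order H
  upper = γ-□-upper-bound G H (degree<2⇒pendant G conG 3≤G v (≰⇒> 2≰deg)) H-edge ΓG γX
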